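{- Let $G$ be a chordal graph with evaporation sequence $L_1,\dots,L_t$ and exception set $X$, where $t\ge 2$, and suppose $X\cup L_t$ is a clique. Then one of the following holds: (1) there is at most one connected component $C$ of $G[L_{t-1}]$ with $\hat N(C)=X\cup L_t$, and $\mathcal{S}_G\setminus\{X\cup L_t\}$ is a set cover for $L_t$; (2) there are at least two distinct connected components $C_1,C_2$ of $G[L_{t-1}]$ with $\hat N(C_i)=X\cup L_t$ for $i\in\{1,2\}$.
   Context: A vertex is simplicial if its neighborhood is a clique. For a chordal graph $G$ and a clique $X\subseteq V(G)$, the evaporation sequence of $G$ with exception set $X$ is defined recursively: if $X=V(G)$ it is the empty sequence; otherwise let $L_1$ be the set of simplicial vertices of $G$ minus $X$ (this is nonempty), and the sequence is $L_1$ followed by the evaporation sequence of $G\setminus L_1$ (the induced subgraph on $V(G)\setminus L_1$) with exception set $X$. For a connected component $C$ of $G[L_{t-1}]$, define $\hat N(C)=N_G(v)\cap(X\cup L_t)$ for any $v\in C$ (this set is the same for all $v\in C$). Let $\mathcal{S}_G=\{\hat N(C): C\text{ a connected component of }G[L_{t-1}]\}$, a family of subsets of $X\cup L_t$. A family $\mathcal{S}$ is a set cover for $L$ if $\bigcup_{S\in\mathcal{S}}S\supseteq L$. -}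

module Defs where

open import Data.Nat using (ℕ; zero; suc; _≤_)
open import Data.Bool using (Bool; true; false)
open import Data.Fin using (Fin; toℕ)
open import Data.Fin.Subset using (Subset; _∈_; _∉_; _∩_; _─_)
open import Data.Vec using (tabulate)
open import Data.List using (List; []; _∷_)
open import Data.Product using (Σ; ∃; _×_; _,_)
open import Data.Sum using (_⊎_)
open import Relation.Nullary using (¬_)
open import Relation.Binary.PropositionalEquality using (_≡_; _≢_)
open import Function.Definitions using (Injective)

record Graph (n : ℕ) : Set where
  field
    adj    : Fin n → Fin n → Bool
    sym    : ∀ u v → adj u v ≡ adj v u
    irrefl : ∀ v → adj v v ≡ false

module _ {n : ℕ} (G : Graph n) where
  open Graph G

  Adj : Fin n → Fin n → Set
  Adj u v = adj u v ≡ true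

  nbhd : Fin n → Subset n
  nbhd v = tabulate (adj v)

  IsClique : Subset n → Set
  IsClique S = ∀ u v → u ∈ S → v ∈ S → u ≢ v → Adj u v

  Simplicial : Subset n → Fin n → Set
  Simplicial R v = v ∈ R × (∀ u w → u ∈ R → w ∈ R → Adj v u → Adj v w → u ≢ w → Adj u w)

  Consec : {k : ℕ} → Fin k → Fin k → Set
  Consec {k} i j = suc (toℕ i) ≡ toℕ j ⊎ suc (toℕ j) ≡ toℕ i
                 ⊎ (toℕ i ≡ 0 × suc (toℕ j) ≡ k) ⊎ (toℕ j ≡ 0 × suc (toℕ i) ≡ k)

  Chordal : Set
  Chordal = ∀ (k : ℕ) → 4 ≤ k → (c : Fin k → Fin n) → Injective _≡_ _≡_ c
          → (∀ i j → Consec i j → Adj (c i) (c j))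
          → Σ (Fin k) λ i → Σ (Fin k) λ j → i ≢ j × ¬ Consec i j × Adj (c i) (c j)

  data Evap (X : Subset n) : Subset n → List (Subset n) → Set where
    done : ∀ {R} → R ≡ X → Evap X R []
    step : ∀ {R L Ls} → R ≢ X
         → (∀ v → (v ∈ L → v ∈ R × v ∉ X × Simplicial R v)
                × (v ∈ R × v ∉ X × Simplicial R v → v ∈ L))
         → Evap X (R ─ L) Ls → Evap X R (L ∷ Ls)

  data Reach (S : Subset n) : Fin n → Fin n → Set where
    here : ∀ {v} → Reach S v v
    next : ∀ {u v w} → Reach S u v → Adj v w → w ∈ S → Reach S u w

  record Component (S : Subset n) : Set where
    field
      set   : Subset n
      rep   : Fin n
      rep∈S : rep ∈ S
      spec  : ∀ u → (u ∈ set → Reach S rep u) × (Reach S rep u → u ∈ set)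

  -- N̂(C) = N_G(v) ∩ Y for v ∈ C (here v = the representative); Y = X ∪ L_t
  NHat : (Y : Subset n) → {S : Subset n} → Component S → Subset n
  NHat Y C = nbhd (Component.rep C) ∩ Y

-- Every vertex of L_{t-1} is simplicial in the graph G_{t-1} = G[L_{t-1} ∪ L_t ∪ X] that is
-- evaporated at step t-1, so every component of G[L_{t-1}] is a clique, and two components are
-- distinct exactly when their representatives are distinct and non-adjacent.  If two such
-- representatives are both complete to X ∪ L_t we are in case (2).  Otherwise at most one
-- component is complete to X ∪ L_t, and a vertex u ∈ L_t, not being simplicial in G_{t-1},
-- has two non-adjacent neighbours w₁, w₂ there.  They cannot both lie in the clique X ∪ L_t,
-- so one of them, say w₁, lies in L_{t-1}; its component misses w₂ (if w₂ ∈ X ∪ L_t) or is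
-- not the complete one (if w₂ ∈ L_{t-1}), and it sees u.
module Submission where

open import Defs
open import Data.Nat using (ℕ)
open import Data.Bool using (true)
open import Data.Bool.Properties using (T-≡) renaming (_≟_ to _≟ᵇ_)
open import Data.Fin using (Fin)
open import Data.Fin.Properties using (any?) renaming (_≟_ to _≟ᶠ_)
open import Data.Fin.Subset using (Subset; _∈_; _∉_; _∪_; _∩_; _─_; _⊆_; ⊤)
open import Data.Fin.Subset.Properties
  using (_∈?_; x∈p∩q⁺; x∈p∩q⁻; x∈p∪q⁺; x∈p∧x∉q⇒x∈p─q; p─q⊆p; ⊆-antisym)
open import Data.List using (List; []; _∷_; _++_)
open import Data.Vec using (tabulate; _∷_; there)
open import Data.Vec.Properties using (lookup∘tabulate; []=⇒lookup; lookup⇒[]=; ≡-dec)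
open import Data.Product using (Σ; ∃; ∃₂; _×_; _,_; proj₁; proj₂)
open import Data.Sum using (_⊎_; inj₁; inj₂)
open import Data.Empty using (⊥-elim)
open import Function using (_∘_; flip)
open import Function.Bundles using (Equivalence)
open import Relation.Nullary using (¬_; Dec; yes; no)
open import Relation.Nullary.Decidable using (_×-dec_; _⊎-dec_; ¬?; ⌊_⌋; toWitness; fromWitness)
open import Relation.Binary.PropositionalEquality using (_≡_; _≢_; refl; sym; trans; subst)

∈-tabulate⁺ : ∀ {n} (f : Fin n → _) {x} → f x ≡ true → x ∈ tabulate f
∈-tabulate⁺ f {x} fx = lookup⇒[]= x (tabulate f) (trans (lookup∘tabulate f x) fx)

∈-tabulate⁻ : ∀ {n} (f : Fin n → _) {x} → x ∈ tabulate f → f x ≡ true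
∈-tabulate⁻ f {x} x∈ = trans (sym (lookup∘tabulate f x)) ([]=⇒lookup x∈)

x∈p─q⇒x∉q : ∀ {n} {x : Fin n} (p q : Subset n) → x ∈ p ─ q → x ∉ q
x∈p─q⇒x∉q (_ ∷ p) (_ ∷ q) (there x∈) (there x∈q) = x∈p─q⇒x∉q p q x∈ x∈q

module _ {n : ℕ} (G : Graph n) where
  open Graph G using (adj)

  Adj? : ∀ u v → Dec (Adj G u v)
  Adj? u v = adj u v ≟ᵇ true

  Adj-sym : ∀ {u v} → Adj G u v → Adj G v u
  Adj-sym {u} {v} = trans (sym (Graph.sym G u v))

  ∈nbhd⁺ : ∀ {u v} → Adj G v u → u ∈ nbhd G v
  ∈nbhd⁺ {v = v} = ∈-tabulate⁺ (adj v)

  ∈nbhd⁻ : ∀ {u v} → u ∈ nbhd G v → Adj G v u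
  ∈nbhd⁻ {v = v} = ∈-tabulate⁻ (adj v)

  NonAdjacentNeighbours : Subset n → Fin n → Fin n → Fin n → Set
  NonAdjacentNeighbours R u w₁ w₂ =
    w₁ ∈ R × w₂ ∈ R × Adj G u w₁ × Adj G u w₂ × w₁ ≢ w₂ × ¬ Adj G w₁ w₂

  ¬Simplicial⇒nonAdjacentNeighbours : ∀ {R u} → u ∈ R → ¬ Simplicial G R u
                                    → ∃₂ (NonAdjacentNeighbours R u)
  ¬Simplicial⇒nonAdjacentNeighbours {R} {u} u∈R ¬simplicial
    with any? (λ w₁ → any? (λ w₂ → nonAdjacentNeighbours? w₁ w₂))
    where
    nonAdjacentNeighbours? : ∀ w₁ w₂ → Dec (NonAdjacentNeighbours R u w₁ w₂)
    nonAdjacentNeighbours? w₁ w₂ = (w₁ ∈? R) ×-dec (w₂ ∈? R) ×-dec Adj? u w₁ ×-dec Adj? u w₂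
                                   ×-dec ¬? (w₁ ≟ᶠ w₂) ×-dec ¬? (Adj? w₁ w₂)
  ... | yes (w₁ , w₂ , witness) = w₁ , w₂ , witness
  ... | no none = ⊥-elim (¬simplicial (u∈R , neighbourhoodClique))
    where
    neighbourhoodClique : ∀ w₁ w₂ → w₁ ∈ R → w₂ ∈ R → Adj G u w₁ → Adj G u w₂ → w₁ ≢ w₂
                        → Adj G w₁ w₂
    neighbourhoodClique w₁ w₂ w₁∈R w₂∈R u~w₁ u~w₂ w₁≢w₂ with Adj? w₁ w₂
    ... | yes w₁~w₂ = w₁~w₂
    ... | no w₁≁w₂ = ⊥-elim (none (w₁ , w₂ , w₁∈R , w₂∈R , u~w₁ , u~w₂ , w₁≢w₂ , w₁≁w₂))

  module _ {S : Subset n} where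

    Reach-∈ : ∀ {a v} → a ∈ S → Reach G S a v → v ∈ S
    Reach-∈ a∈S here = a∈S
    Reach-∈ a∈S (next _ _ v∈S) = v∈S

    Reach-trans : ∀ {a b c} → Reach G S a b → Reach G S b c → Reach G S a c
    Reach-trans r here = r
    Reach-trans r (next r′ e w∈S) = next (Reach-trans r r′) e w∈S

    Reach-cons : ∀ {a b c} → Adj G a b → b ∈ S → Reach G S b c → Reach G S a c
    Reach-cons a~b b∈S here = next here a~b b∈S
    Reach-cons a~b b∈S (next r e w∈S) = next (Reach-cons a~b b∈S r) e w∈S

    Reach-sym : ∀ {a b} → a ∈ S → Reach G S a b → Reach G S b a
    Reach-sym a∈S here = here
    Reach-sym a∈S (next r v~w _) = Reach-cons (Adj-sym v~w) (Reach-∈ a∈S r) (Reach-sym a∈S r)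

    module _ (C : Component G S) where
      open Component C

      rep∈set : rep ∈ set
      rep∈set = proj₂ (spec rep) here

      ∈set⇒Reach : ∀ {u} → u ∈ set → Reach G S rep u
      ∈set⇒Reach {u} = proj₁ (spec u)

      Reach⇒∈set : ∀ {u} → Reach G S rep u → u ∈ set
      Reach⇒∈set {u} = proj₂ (spec u)

    Reach⇒set≡ : (C₁ C₂ : Component G S) → Reach G S (Component.rep C₁) (Component.rep C₂)
               → Component.set C₁ ≡ Component.set C₂
    Reach⇒set≡ C₁ C₂ r = ⊆-antisym
      (Reach⇒∈set C₂ ∘ Reach-trans (Reach-sym (Component.rep∈S C₁) r) ∘ ∈set⇒Reach C₁)
      (Reach⇒∈set C₁ ∘ Reach-trans r ∘ ∈set⇒Reach C₂)

    set≡⇒Reach : (C₁ C₂ : Component G S) → Component.set C₁ ≡ Component.set C₂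
               → Reach G S (Component.rep C₁) (Component.rep C₂)
    set≡⇒Reach C₁ C₂ eq = ∈set⇒Reach C₁ (subst (_ ∈_) (sym eq) (rep∈set C₂))

  module SimplicialComponents {R S : Subset n} (S⊆R : S ⊆ R)
    (simplicial : ∀ {v} → v ∈ S → Simplicial G R v) where

    Reach⇒≡⊎Adj : ∀ {a v} → a ∈ S → Reach G S a v → a ≡ v ⊎ Adj G a v
    Reach⇒≡⊎Adj a∈S here = inj₁ refl
    Reach⇒≡⊎Adj {a} a∈S (next {w = w} r v~w w∈S) with Reach⇒≡⊎Adj a∈S r
    ... | inj₁ refl = inj₂ v~w
    ... | inj₂ a~v with a ≟ᶠ w
    ...   | yes a≡w = inj₁ a≡w
    ...   | no a≢w = inj₂ (proj₂ (simplicial (Reach-∈ a∈S r)) a w (S⊆R a∈S) (S⊆R w∈S) (Adj-sym a~v) v~w a≢w)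

    ≡⊎Adj⇒Reach : ∀ {a v} → v ∈ S → a ≡ v ⊎ Adj G a v → Reach G S a v
    ≡⊎Adj⇒Reach v∈S (inj₁ refl) = here
    ≡⊎Adj⇒Reach v∈S (inj₂ a~v) = next here a~v v∈S

    closedNeighbour? : ∀ a v → Dec (v ∈ S × (a ≡ v ⊎ Adj G a v))
    closedNeighbour? a v = (v ∈? S) ×-dec ((a ≟ᶠ v) ⊎-dec Adj? a v)

    componentOf : ∀ a → a ∈ S → Component G S
    componentOf a a∈S = record
      { set   = tabulate (λ v → ⌊ closedNeighbour? a v ⌋)
      ; rep   = a
      ; rep∈S = a∈S
      ; spec  = λ u →
          (λ u∈ → let v∈S , a≈v = toWitness (Equivalence.from T-≡ (∈-tabulate⁻ _ u∈))
                  in ≡⊎Adj⇒Reach v∈S a≈v)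
        , (λ r → ∈-tabulate⁺ _ (Equivalence.to T-≡ (fromWitness (Reach-∈ a∈S r , Reach⇒≡⊎Adj a∈S r))))
      }

    set≢ : (C₁ C₂ : Component G S) → Component.rep C₁ ≢ Component.rep C₂
         → ¬ Adj G (Component.rep C₁) (Component.rep C₂) → Component.set C₁ ≢ Component.set C₂
    set≢ C₁ C₂ r₁≢r₂ r₁≁r₂ eq with Reach⇒≡⊎Adj (Component.rep∈S C₁) (set≡⇒Reach C₁ C₂ eq)
    ... | inj₁ r₁≡r₂ = r₁≢r₂ r₁≡r₂
    ... | inj₂ r₁~r₂ = r₁≁r₂ r₁~r₂

    ¬[≢×≁]⇒set≡ : (C₁ C₂ : Component G S)
             → ¬ (Component.rep C₁ ≢ Component.rep C₂ × ¬ Adj G (Component.rep C₁) (Component.rep C₂))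
             → Component.set C₁ ≡ Component.set C₂
    ¬[≢×≁]⇒set≡ C₁ C₂ ¬apart with Component.rep C₁ ≟ᶠ Component.rep C₂ | Adj? (Component.rep C₁) (Component.rep C₂)
    ... | yes r₁≡r₂ | _ = Reach⇒set≡ C₁ C₂ (≡⊎Adj⇒Reach (Component.rep∈S C₂) (inj₁ r₁≡r₂))
    ... | no _ | yes r₁~r₂ = Reach⇒set≡ C₁ C₂ (≡⊎Adj⇒Reach (Component.rep∈S C₂) (inj₂ r₁~r₂))
    ... | no r₁≢r₂ | no r₁≁r₂ = ⊥-elim (¬apart (r₁≢r₂ , r₁≁r₂))

  CompleteTo : Subset n → Fin n → Set
  CompleteTo Y a = nbhd G a ∩ Y ≡ Y

  CompleteTo? : ∀ Y a → Dec (CompleteTo Y a)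
  CompleteTo? Y a = ≡-dec _≟ᵇ_ (nbhd G a ∩ Y) Y

  CompleteTo⇒Adj : ∀ {Y a w} → CompleteTo Y a → w ∈ Y → Adj G a w
  CompleteTo⇒Adj {Y} {a} complete w∈Y =
    ∈nbhd⁻ (proj₁ (x∈p∩q⁻ (nbhd G a) Y (subst (_ ∈_) (sym complete) w∈Y)))

  EvaporationLayer : Subset n → Subset n → Subset n → Set
  EvaporationLayer X R L = ∀ v → (v ∈ L → v ∈ R × v ∉ X × Simplicial G R v)
                                × (v ∈ R × v ∉ X × Simplicial G R v → v ∈ L)

  Evap-suffix : ∀ {X R} (pre rest : List (Subset n)) → Evap G X R (pre ++ rest)
              → ∃ λ R′ → Evap G X R′ rest
  Evap-suffix [] rest e = _ , e
  Evap-suffix (_ ∷ pre) rest (step _ _ e) = Evap-suffix pre rest e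

module LastTwoLayers {n : ℕ} (G : Graph n) (X R Lp Lt : Subset n)
  (layerP : EvaporationLayer G X R Lp)
  (layerT : EvaporationLayer G X (R ─ Lp) Lt)
  (rest : R ─ Lp ─ Lt ≡ X)
  (Y-clique : IsClique G (X ∪ Lt)) where

  Y : Subset n
  Y = X ∪ Lt

  Lp⊆R : Lp ⊆ R
  Lp⊆R {v} = proj₁ ∘ proj₁ (layerP v)

  open SimplicialComponents G Lp⊆R (λ {v} → proj₂ ∘ proj₂ ∘ proj₁ (layerP v))

  Lt⊆R─Lp : Lt ⊆ R ─ Lp
  Lt⊆R─Lp {v} = proj₁ ∘ proj₁ (layerT v)

  R⊆Lp∪Y : ∀ {v} → v ∈ R → v ∈ Lp ⊎ v ∈ Y
  R⊆Lp∪Y {v} v∈R with v ∈? Lp | v ∈? Lt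
  ... | yes v∈Lp | _ = inj₁ v∈Lp
  ... | no _ | yes v∈Lt = inj₂ (x∈p∪q⁺ (inj₂ v∈Lt))
  ... | no v∉Lp | no v∉Lt =
    inj₂ (x∈p∪q⁺ (inj₁ (subst (v ∈_) rest (x∈p∧x∉q⇒x∈p─q (x∈p∧x∉q⇒x∈p─q v∈R v∉Lp) v∉Lt))))

  -- Otherwise u would already have evaporated into L_{t-1}.
  Lt-¬simplicial : ∀ {u} → u ∈ Lt → ¬ Simplicial G R u
  Lt-¬simplicial {u} u∈Lt simplicial =
    x∈p─q⇒x∉q R Lp u∈R─Lp (proj₂ (layerP u) (u∈R , proj₁ (proj₂ (proj₁ (layerT u) u∈Lt)) , simplicial))
    where
    u∈R─Lp = Lt⊆R─Lp u∈Lt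
    u∈R = p─q⊆p R Lp u∈R─Lp

  TwoComplete : Fin n → Fin n → Set
  TwoComplete a b = a ∈ Lp × b ∈ Lp × a ≢ b × ¬ Adj G a b × CompleteTo G Y a × CompleteTo G Y b

  TwoComplete? : ∀ a b → Dec (TwoComplete a b)
  TwoComplete? a b = (a ∈? Lp) ×-dec (b ∈? Lp) ×-dec ¬? (a ≟ᶠ b) ×-dec ¬? (Adj? G a b)
                     ×-dec CompleteTo? G Y a ×-dec CompleteTo? G Y b

  twoCompleteComponents : ∀ {a b} → TwoComplete a b
    → Σ (Component G Lp) λ C₁ → Σ (Component G Lp) λ C₂
        → Component.set C₁ ≢ Component.set C₂ × NHat G Y C₁ ≡ Y × NHat G Y C₂ ≡ Y
  twoCompleteComponents {a} {b} (a∈Lp , b∈Lp , a≢b , a≁b , a-complete , b-complete) =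
    C₁ , C₂ , set≢ C₁ C₂ a≢b a≁b , a-complete , b-complete
    where
    C₁ = componentOf a a∈Lp
    C₂ = componentOf b b∈Lp

  uniqueCompleteComponent : ¬ ∃₂ TwoComplete → (C₁ C₂ : Component G Lp)
    → NHat G Y C₁ ≡ Y → NHat G Y C₂ ≡ Y → Component.set C₁ ≡ Component.set C₂
  uniqueCompleteComponent none C₁ C₂ C₁-complete C₂-complete = ¬[≢×≁]⇒set≡ C₁ C₂ λ (r₁≢r₂ , r₁≁r₂) →
    none (Component.rep C₁ , Component.rep C₂ , Component.rep∈S C₁ , Component.rep∈S C₂ ,
          r₁≢r₂ , r₁≁r₂ , C₁-complete , C₂-complete)

  incompleteComponentsCover : ¬ ∃₂ TwoComplete → ∀ u → u ∈ Lt
    → Σ (Component G Lp) λ C → NHat G Y C ≢ Y × u ∈ NHat G Y C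
  incompleteComponentsCover none u u∈Lt
    with ¬Simplicial⇒nonAdjacentNeighbours G u∈R (Lt-¬simplicial u∈Lt)
    where u∈R = p─q⊆p R Lp (Lt⊆R─Lp u∈Lt)
  ... | w₁ , w₂ , w₁∈R , w₂∈R , u~w₁ , u~w₂ , w₁≢w₂ , w₁≁w₂ = cover (R⊆Lp∪Y w₁∈R) (R⊆Lp∪Y w₂∈R)
    where
    sees-u : ∀ {w} → Adj G u w → u ∈ nbhd G w ∩ Y
    sees-u u~w = x∈p∩q⁺ (∈nbhd⁺ G (Adj-sym G u~w) , x∈p∪q⁺ (inj₂ u∈Lt))

    incomplete : ∀ {a w} → w ∈ Y → ¬ Adj G a w → ¬ CompleteTo G Y a
    incomplete w∈Y a≁w = a≁w ∘ flip (CompleteTo⇒Adj G) w∈Y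

    cover : w₁ ∈ Lp ⊎ w₁ ∈ Y → w₂ ∈ Lp ⊎ w₂ ∈ Y
          → Σ (Component G Lp) λ C → NHat G Y C ≢ Y × u ∈ NHat G Y C
    cover (inj₁ w₁∈Lp) (inj₁ w₂∈Lp) with CompleteTo? G Y w₁ | CompleteTo? G Y w₂
    ... | no w₁-incomplete | _ = componentOf w₁ w₁∈Lp , w₁-incomplete , sees-u u~w₁
    ... | yes _ | no w₂-incomplete = componentOf w₂ w₂∈Lp , w₂-incomplete , sees-u u~w₂
    ... | yes w₁-complete | yes w₂-complete =
      ⊥-elim (none (w₁ , w₂ , w₁∈Lp , w₂∈Lp , w₁≢w₂ , w₁≁w₂ , w₁-complete , w₂-complete))
    cover (inj₁ w₁∈Lp) (inj₂ w₂∈Y) = componentOf w₁ w₁∈Lp , incomplete w₂∈Y w₁≁w₂ , sees-u u~w₁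
    cover (inj₂ w₁∈Y) (inj₁ w₂∈Lp) =
      componentOf w₂ w₂∈Lp , incomplete w₁∈Y (w₁≁w₂ ∘ Adj-sym G) , sees-u u~w₂
    cover (inj₂ w₁∈Y) (inj₂ w₂∈Y) = ⊥-elim (w₁≁w₂ (Y-clique w₁ w₂ w₁∈Y w₂∈Y w₁≢w₂))

  dichotomy : ((∀ (C₁ C₂ : Component G Lp) → NHat G Y C₁ ≡ Y → NHat G Y C₂ ≡ Y
                  → Component.set C₁ ≡ Component.set C₂)
               × (∀ (u : Fin n) → u ∈ Lt → Σ (Component G Lp) λ C → NHat G Y C ≢ Y × u ∈ NHat G Y C))
            ⊎ Σ (Component G Lp) λ C₁ → Σ (Component G Lp) λ C₂
                → Component.set C₁ ≢ Component.set C₂ × NHat G Y C₁ ≡ Y × NHat G Y C₂ ≡ Y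
  dichotomy with any? (λ a → any? (TwoComplete? a))
  ... | yes (_ , _ , twoComplete) = inj₂ (twoCompleteComponents twoComplete)
  ... | no none = inj₁ (uniqueCompleteComponent none , incompleteComponentsCover none)

lemma5p15 : ∀ {n : ℕ} (G : Graph n) (X : Subset n) (Ls pre : List (Subset n)) (Lp Lt : Subset n)
    → Chordal G → IsClique G X
    → Evap G X ⊤ Ls → Ls ≡ pre ++ (Lp ∷ Lt ∷ [])
    → IsClique G (X ∪ Lt)
    → ((∀ (C₁ C₂ : Component G Lp) → NHat G (X ∪ Lt) C₁ ≡ X ∪ Lt → NHat G (X ∪ Lt) C₂ ≡ X ∪ Lt
          → Component.set C₁ ≡ Component.set C₂)
       × (∀ (u : Fin n) → u ∈ Lt
          → Σ (Component G Lp) λ C → NHat G (X ∪ Lt) C ≢ X ∪ Lt × u ∈ NHat G (X ∪ Lt) C))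
      ⊎ Σ (Component G Lp) λ C₁ → Σ (Component G Lp) λ C₂
          → Component.set C₁ ≢ Component.set C₂
          × NHat G (X ∪ Lt) C₁ ≡ X ∪ Lt × NHat G (X ∪ Lt) C₂ ≡ X ∪ Lt
lemma5p15 G X Ls pre Lp Lt _ _ evap refl Y-clique with Evap-suffix G pre (Lp ∷ Lt ∷ []) evap
... | R , step _ layerP (step _ layerT (done rest)) =
  LastTwoLayers.dichotomy G X R Lp Lt layerP layerT rest Y-clique
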